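{- Let $T$ be a singular weighted tree with adjacency matrix $A$. Then $A$ and $A^{\#}$ have the same zero–nonzero pattern if and only if $T$ is a weighted star.
   Context: A weighted tree is a tree with a nonzero real weight on each edge; its adjacency matrix $A$ has $(i,j)$ entry equal to the weight of edge $v_iv_j$, or $0$ if no edge; $T$ is singular if $A$ is singular. The group inverse $A^{\#}$ is the unique matrix $X$ with $AXA=A$, $XAX=X$, $AX=XA$. -}

module Defs where

open import Level using (0ℓ)
open import Data.Nat using (ℕ; zero; suc)
open import Data.Fin using (Fin; zero; suc; inject₁; fromℕ)
open import Data.Product using (Σ; ∃; _×_; _,_)
open import Data.Sum using (_⊎_)
open import Relation.Nullary using (¬_)
open import Relation.Binary.PropositionalEquality using (_≡_)
open import Relation.Binary.Structures using (IsTotalOrder)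
open import Algebra.Bundles using (CommutativeRing)
open import Function.Definitions using (Injective)

record OrderedField : Set₁ where
  field
    commRing : CommutativeRing 0ℓ 0ℓ
  open CommutativeRing commRing public
  field
    _≤_           : Carrier → Carrier → Set
    isTotalOrder  : IsTotalOrder _≈_ _≤_
    +-mono-≤      : ∀ {x y} z → x ≤ y → (x + z) ≤ (y + z)
    *-nonneg      : ∀ {x y} → 0# ≤ x → 0# ≤ y → 0# ≤ (x * y)
    1≉0           : ¬ (1# ≈ 0#)
    inverse       : ∀ x → ¬ (x ≈ 0#) → ∃ λ y → (x * y) ≈ 1#

module Matrices (F : OrderedField) where
  open OrderedField F using (Carrier; _≈_; _+_; _*_; 0#; 1#)

  Matrix : ℕ → Set
  Matrix n = Fin n → Fin n → Carrier

  Σ[_] : ∀ {n} → (Fin n → Carrier) → Carrier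
  Σ[_] {zero}  f = 0#
  Σ[_] {suc n} f = f zero + Σ[_] (λ i → f (suc i))

  _⊗_ : ∀ {n} → Matrix n → Matrix n → Matrix n
  (M ⊗ N) i j = Σ[ (λ k → M i k * N k j) ]

  _≋_ : ∀ {n} → Matrix n → Matrix n → Set
  M ≋ N = ∀ i j → M i j ≈ N i j

  identity : ∀ {n} → Matrix n
  identity i j with i Data.Fin.≟ j
  ... | Relation.Nullary.yes _ = 1#
  ... | Relation.Nullary.no  _ = 0#

  Singular : ∀ {n} → Matrix n → Set
  Singular {n} A = ¬ (Σ (Matrix n) λ B → ((A ⊗ B) ≋ identity) × ((B ⊗ A) ≋ identity))

  IsGroupInverse : ∀ {n} → Matrix n → Matrix n → Set
  IsGroupInverse A X = (((A ⊗ X) ⊗ A) ≋ A) × (((X ⊗ A) ⊗ X) ≋ X) × ((A ⊗ X) ≋ (X ⊗ A))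

  SamePattern : ∀ {n} → Matrix n → Matrix n → Set
  SamePattern A X = ∀ i j → (A i j ≈ 0# → X i j ≈ 0#) × (X i j ≈ 0# → A i j ≈ 0#)

  -- Weighted graphs given by their adjacency matrix:
  -- v_i v_j is an edge iff A i j ≉ 0, with weight A i j.

  Symmetric : ∀ {n} → Matrix n → Set
  Symmetric A = ∀ i j → A i j ≈ A j i

  ZeroDiagonal : ∀ {n} → Matrix n → Set
  ZeroDiagonal A = ∀ i → A i i ≈ 0#

  Adj : ∀ {n} → Matrix n → Fin n → Fin n → Set
  Adj A i j = ¬ (A i j ≈ 0#)

  data Walk {n} (A : Matrix n) : Fin n → Fin n → Set where
    here : ∀ {i} → Walk A i i
    step : ∀ {i j k} → Adj A i j → Walk A j k → Walk A i k

  Connected : ∀ {n} → Matrix n → Set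
  Connected A = ∀ i j → Walk A i j

  Cycle : ∀ {n} → Matrix n → Set
  Cycle {n} A =
    Σ ℕ λ k → Σ (Fin (suc (suc (suc k))) → Fin n) λ v →
      Injective _≡_ _≡_ v
      × (∀ (i : Fin (suc (suc k))) → Adj A (v (inject₁ i)) (v (suc i)))
      × Adj A (v (fromℕ (suc (suc k)))) (v zero)

  Acyclic : ∀ {n} → Matrix n → Set
  Acyclic A = ¬ Cycle A

  -- A is the adjacency matrix of a weighted tree (on n ≥ 1 vertices)
  IsWeightedTree : ∀ {n} → Matrix n → Set
  IsWeightedTree {n} A = Fin n × Symmetric A × ZeroDiagonal A × Connected A × Acyclic A

  IsStar : ∀ {n} → Matrix n → Set
  IsStar {n} A = Σ (Fin n) λ c → ∀ i j → Adj A i j → (i ≡ c) ⊎ (j ≡ c)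

-- If T is a star with centre c, let e be the c-th unit vector and w the column of A at c. Then
-- A = e wᵀ + w eᵀ with eᵀw = 0, so A³ = sA for s = wᵀw ≠ 0, and the group-inverse equations force
-- A^# = A/s. Constructively, the vertex pairs that are not edges of the star only give entries that
-- are not-not zero; they are shown to vanish by Gaussian elimination with the invertible pivots
-- 1 − u (u not-not zero), applied to a vector fixed by AA^#.
-- Conversely, if A^# has the pattern of A and a – b – c – d is a path with a, d not adjacent, then
-- that path is the only walk of length 3 from a to d, so (AA^#A)_ad = A_ab A^#_bc A_cd ≠ 0 = A_ad.
-- A connected graph with neither such paths nor triangles is a star.

module Submission where

open import Defs
open import Data.Nat using (ℕ; zero; suc)
open import Data.Fin using (Fin; zero; suc; _≟_; inject₁; fromℕ; punchIn)
open import Data.Fin.Properties using (punchInᵢ≢i)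
open import Data.Product using (_×_; ∃; _,_; proj₁; proj₂)
open import Data.Sum using (_⊎_; inj₁; inj₂; [_,_]′)
open import Data.Empty using (⊥; ⊥-elim)
open import Function using (_∘_)
open import Relation.Nullary using (¬_; Dec; yes; no)
open import Relation.Binary.PropositionalEquality as ≡ using (_≡_; _≢_)
open import Relation.Binary.Structures using (IsTotalOrder)
open import Relation.Nullary.Decidable using (¬¬-excluded-middle)
open import Relation.Nullary.Negation using (¬¬-map; contradiction)
open import Data.Vec using (Vec; []; _∷_; lookup)
open import Data.Vec.Relation.Unary.All using ([]; _∷_)
open import Data.Vec.Relation.Unary.AllPairs using ([]; _∷_)
open import Data.Vec.Relation.Unary.Unique.Propositional using (Unique)
open import Data.Vec.Relation.Unary.Unique.Propositional.Properties using (lookup-injective)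
import Algebra.Properties.Ring as RingProperties
import Algebra.Properties.CommutativeSemigroup as CommutativeSemigroupProperties
import Algebra.Properties.Semiring.Sum as SemiringSum

module _ (F : OrderedField) where
  open OrderedField F hiding (zero)
  open Matrices F
  open RingProperties ring
    using (-‿distribˡ-*; -‿distribʳ-*; -‿involutive; -0#≈0#; -1*x≈-x;
           x[y-z]≈xy-xz; [y-z]x≈yx-zx; x∙y⁻¹≈ε⇒x≈y; x≈y⇒x∙y⁻¹≈ε; //-rightDividesʳ)
  open CommutativeSemigroupProperties *-commutativeSemigroup
    using (x∙yz≈y∙xz)
  open SemiringSum semiring
    using (sum; sum-cong-≋; sum-replicate-zero; sum-remove; ∑-distrib-+; ∑-comm;
           *-distribˡ-sum; *-distribʳ-sum)
  open IsTotalOrder isTotalOrder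
    using (total; antisym; ≲-respˡ-≈; ≲-respʳ-≈) renaming (refl to ≤-refl; trans to ≤-trans)
  open import Relation.Binary.Reasoning.Setoid setoid

  product≈0 : ∀ {u v} → Dec (u ≈ 0#) → Dec (v ≈ 0#) → (¬ u ≈ 0# → ¬ v ≈ 0# → ⊥) → u * v ≈ 0#
  product≈0 {u} {v} (yes u≈0) _         _ = trans (*-congʳ u≈0) (zeroˡ v)
  product≈0 {u} {v} (no _)    (yes v≈0) _ = trans (*-congˡ v≈0) (zeroʳ u)
  product≈0         (no u≉0)  (no v≉0)  u≉0→v≉0→⊥ = ⊥-elim (u≉0→v≉0→⊥ u≉0 v≉0)

  x≈y+z⇒x-y≈z : ∀ {x y z} → x ≈ y + z → x - y ≈ z
  x≈y+z⇒x-y≈z {x} {y} {z} x≈y+z = trans (+-congʳ (trans x≈y+z (+-comm y z))) (//-rightDividesʳ y z)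

  inverseOf : ∀ x → ¬ x ≈ 0# → Carrier
  inverseOf x x≉0 = proj₁ (inverse x x≉0)

  *-inverseOf : ∀ x (x≉0 : ¬ x ≈ 0#) → x * inverseOf x x≉0 ≈ 1#
  *-inverseOf x x≉0 = proj₂ (inverse x x≉0)

  x*y≈0⇒y≈0 : ∀ {x y} → ¬ x ≈ 0# → x * y ≈ 0# → y ≈ 0#
  x*y≈0⇒y≈0 {x} {y} x≉0 xy≈0 = begin
    y                 ≈⟨ *-identityˡ y ⟨
    1# * y            ≈⟨ *-congʳ (*-inverseOf x x≉0) ⟨
    (x * x⁻¹) * y     ≈⟨ *-congʳ (*-comm x x⁻¹) ⟩
    (x⁻¹ * x) * y     ≈⟨ *-assoc x⁻¹ x y ⟩
    x⁻¹ * (x * y)     ≈⟨ *-congˡ xy≈0 ⟩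
    x⁻¹ * 0#          ≈⟨ zeroʳ x⁻¹ ⟩
    0#                ∎
    where x⁻¹ = inverseOf x x≉0

  *-nonzero : ∀ {x y} → ¬ x ≈ 0# → ¬ y ≈ 0# → ¬ x * y ≈ 0#
  *-nonzero x≉0 y≉0 xy≈0 = y≉0 (x*y≈0⇒y≈0 x≉0 xy≈0)

  *-cancelˡ-nonzero : ∀ {a x y} → ¬ a ≈ 0# → a * x ≈ a * y → x ≈ y
  *-cancelˡ-nonzero {a} {x} {y} a≉0 ax≈ay =
    x∙y⁻¹≈ε⇒x≈y _ _ (x*y≈0⇒y≈0 a≉0 (trans (x[y-z]≈xy-xz a x y) (x≈y⇒x∙y⁻¹≈ε ax≈ay)))

  ≤-respˡʳ-≈ : ∀ {a b c d} → a ≈ b → c ≈ d → a ≤ c → b ≤ d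
  ≤-respˡʳ-≈ a≈b c≈d = ≲-respʳ-≈ c≈d ∘ ≲-respˡ-≈ a≈b

  x≤x+y : ∀ {x y} → 0# ≤ y → x ≤ (x + y)
  x≤x+y {x} {y} 0≤y = ≤-respˡʳ-≈ (+-identityˡ x) (+-comm y x) (+-mono-≤ x 0≤y)

  x≤0⇒0≤-x : ∀ {x} → x ≤ 0# → 0# ≤ (- x)
  x≤0⇒0≤-x {x} x≤0 = ≤-respˡʳ-≈ (-‿inverseʳ x) (+-identityˡ (- x)) (+-mono-≤ (- x) x≤0)

  0≤x*x : ∀ x → 0# ≤ (x * x)
  0≤x*x x with total 0# x
  ... | inj₁ 0≤x = *-nonneg 0≤x 0≤x
  ... | inj₂ x≤0 = ≤-respˡʳ-≈ refl -x*-x≈x*x (*-nonneg (x≤0⇒0≤-x x≤0) (x≤0⇒0≤-x x≤0))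
    where
    -x*-x≈x*x : - x * - x ≈ x * x
    -x*-x≈x*x = begin
      - x * - x      ≈⟨ -‿distribˡ-* x (- x) ⟨
      - (x * - x)    ≈⟨ -‿cong (-‿distribʳ-* x x) ⟨
      - - (x * x)    ≈⟨ -‿involutive (x * x) ⟩
      x * x          ∎

  1+1≉0 : ¬ 1# + 1# ≈ 0#
  1+1≉0 2≈0 = 1≉0 (antisym (≤-respˡʳ-≈ refl 2≈0 (x≤x+y 0≤1)) 0≤1)
    where
    0≤1 : 0# ≤ 1#
    0≤1 = ≤-respˡʳ-≈ refl (*-identityˡ 1#) (0≤x*x 1#)

  x≈-x⇒x≈0 : ∀ {x} → x ≈ - x → x ≈ 0#
  x≈-x⇒x≈0 {x} x≈-x = x*y≈0⇒y≈0 1+1≉0 (begin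
    (1# + 1#) * x     ≈⟨ distribʳ x 1# 1# ⟩
    1# * x + 1# * x   ≈⟨ +-cong (*-identityˡ x) (*-identityˡ x) ⟩
    x + x             ≈⟨ +-congˡ x≈-x ⟩
    x - x             ≈⟨ -‿inverseʳ x ⟩
    0#                ∎)

  sum-neg : ∀ {n} (f : Fin n → Carrier) → sum (λ k → - f k) ≈ - sum f
  sum-neg f = begin
    sum (λ k → - f k)        ≈⟨ sum-cong-≋ (λ k → -1*x≈-x (f k)) ⟨
    sum (λ k → - 1# * f k)   ≈⟨ *-distribˡ-sum (- 1#) f ⟨
    - 1# * sum f             ≈⟨ -1*x≈-x (sum f) ⟩
    - sum f                  ∎

  sum-− : ∀ {n} (f g : Fin n → Carrier) → sum (λ k → f k - g k) ≈ sum f - sum g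
  sum-− f g = trans (∑-distrib-+ f (λ k → - g k)) (+-congˡ (sum-neg g))

  sum-zero : ∀ {n} {f : Fin n → Carrier} → (∀ k → f k ≈ 0#) → sum f ≈ 0#
  sum-zero {n} f≈0 = trans (sum-cong-≋ f≈0) (sum-replicate-zero n)

  sum-single : ∀ {n} {f : Fin n → Carrier} (i : Fin n) → (∀ k → k ≢ i → f k ≈ 0#) → sum f ≈ f i
  sum-single {suc n} {f} i f≈0 = begin
    sum f                     ≈⟨ sum-remove f ⟩
    f i + sum (f ∘ punchIn i) ≈⟨ +-congˡ (sum-zero (λ k → f≈0 _ (punchInᵢ≢i i k))) ⟩
    f i + 0#                  ≈⟨ +-identityʳ (f i) ⟩
    f i                       ∎

  sum-nonneg : ∀ {n} (f : Fin n → Carrier) → (∀ k → 0# ≤ f k) → 0# ≤ sum f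
  sum-nonneg {zero}  f 0≤f = ≤-refl
  sum-nonneg {suc n} f 0≤f =
    ≤-trans (sum-nonneg (f ∘ suc) (0≤f ∘ suc)) (≤-respˡʳ-≈ refl (+-comm _ (f zero)) (x≤x+y (0≤f zero)))

  sum-of-squares≉0 : ∀ {n} (f : Fin n → Carrier) (l : Fin n) → ¬ f l ≈ 0# → ¬ sum (λ k → f k * f k) ≈ 0#
  sum-of-squares≉0 {suc n} f l fl≉0 sum≈0 = *-nonzero fl≉0 fl≉0 (antisym fl²≤0 (0≤x*x (f l)))
    where
    squares = λ k → f k * f k
    fl²≤0 : (f l * f l) ≤ 0#
    fl²≤0 = ≤-respˡʳ-≈ refl (trans (sym (sum-remove squares)) sum≈0)
              (x≤x+y (sum-nonneg _ (λ k → 0≤x*x (f (punchIn l k)))))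

  dot : ∀ {n} → (Fin n → Carrier) → (Fin n → Carrier) → Carrier
  dot u v = sum (λ k → u k * v k)

  col : ∀ {n} → Matrix n → Fin n → Fin n → Carrier
  col M j k = M k j

  mv : ∀ {n} → Matrix n → (Fin n → Carrier) → Fin n → Carrier
  mv M v i = dot (M i) v

  Σ≡sum : ∀ {n} (f : Fin n → Carrier) → Σ[ f ] ≡ sum f
  Σ≡sum {zero}  f = ≡.refl
  Σ≡sum {suc n} f = ≡.cong (f zero +_) (Σ≡sum (f ∘ suc))

  ⊗≈dot : ∀ {n} (M N : Matrix n) i j → (M ⊗ N) i j ≈ dot (M i) (col N j)
  ⊗≈dot M N i j = reflexive (Σ≡sum (λ k → M i k * N k j))

  dot-*ˡ : ∀ {n} a (u v : Fin n → Carrier) → dot (λ k → a * u k) v ≈ a * dot u v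
  dot-*ˡ a u v =
    trans (sum-cong-≋ (λ k → *-assoc a (u k) (v k))) (sym (*-distribˡ-sum a (λ k → u k * v k)))

  dot-*ʳ : ∀ {n} a (u v : Fin n → Carrier) → dot u (λ k → v k * a) ≈ dot u v * a
  dot-*ʳ a u v =
    trans (sum-cong-≋ (λ k → sym (*-assoc (u k) (v k) a))) (sym (*-distribʳ-sum a (λ k → u k * v k)))

  dot-−ˡ : ∀ {n} (u u′ v : Fin n → Carrier) → dot (λ k → u k - u′ k) v ≈ dot u v - dot u′ v
  dot-−ˡ u u′ v = trans (sum-cong-≋ (λ k → [y-z]x≈yx-zx (v k) (u k) (u′ k)))
                          (sum-− (λ k → u k * v k) (λ k → u′ k * v k))

  dot-−ʳ : ∀ {n} (u v v′ : Fin n → Carrier) → dot u (λ k → v k - v′ k) ≈ dot u v - dot u v′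
  dot-−ʳ u v v′ = trans (sum-cong-≋ (λ k → x[y-z]≈xy-xz (u k) (v k) (v′ k)))
                          (sum-− (λ k → u k * v k) (λ k → u k * v′ k))

  dot-linearˡ : ∀ {n} a u (b t v : Fin n → Carrier) →
                    dot (λ k → a * b k + u * t k) v ≈ a * dot b v + u * dot t v
  dot-linearˡ a u b t v = begin
    dot (λ k → a * b k + u * t k) v
      ≈⟨ sum-cong-≋ (λ k → distribʳ (v k) _ _) ⟩
    sum (λ k → a * b k * v k + u * t k * v k)
      ≈⟨ ∑-distrib-+ (λ k → a * b k * v k) (λ k → u * t k * v k) ⟩
    dot (λ k → a * b k) v + dot (λ k → u * t k) v
      ≈⟨ +-cong (dot-*ˡ a b v) (dot-*ˡ u t v) ⟩
    a * dot b v + u * dot t v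
      ∎

  identity-diag : ∀ {n} (c : Fin n) → identity c c ≈ 1#
  identity-diag c with c ≟ c
  ... | yes _   = refl
  ... | no c≢c  = ⊥-elim (c≢c ≡.refl)

  identity-off : ∀ {n} {k c : Fin n} → k ≢ c → identity k c ≈ 0#
  identity-off {k = k} {c} k≢c with k ≟ c
  ... | yes k≡c = ⊥-elim (k≢c k≡c)
  ... | no _    = refl

  dot-identity : ∀ {n} (c : Fin n) (v : Fin n → Carrier) → dot (λ k → identity k c) v ≈ v c
  dot-identity c v = begin
    dot (λ k → identity k c) v   ≈⟨ sum-single c off-c-vanishes ⟩
    identity c c * v c           ≈⟨ *-congʳ (identity-diag c) ⟩
    1# * v c                     ≈⟨ *-identityˡ (v c) ⟩
    v c                          ∎
    where
    off-c-vanishes : ∀ k → k ≢ c → identity k c * v k ≈ 0#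
    off-c-vanishes k k≢c = trans (*-congʳ (identity-off k≢c)) (zeroˡ (v k))

  ⊗-cong : ∀ {n} {M M′ N N′ : Matrix n} → M ≋ M′ → N ≋ N′ → (M ⊗ N) ≋ (M′ ⊗ N′)
  ⊗-cong {M = M} {M′} {N} {N′} M≋M′ N≋N′ i j = begin
    (M ⊗ N) i j              ≈⟨ ⊗≈dot M N i j ⟩
    dot (M i) (col N j)      ≈⟨ sum-cong-≋ (λ k → *-cong (M≋M′ i k) (N≋N′ k j)) ⟩
    dot (M′ i) (col N′ j)    ≈⟨ ⊗≈dot M′ N′ i j ⟨
    (M′ ⊗ N′) i j            ∎

  ⊗-congˡ : ∀ {n} (M : Matrix n) {N N′} → N ≋ N′ → (M ⊗ N) ≋ (M ⊗ N′)
  ⊗-congˡ M = ⊗-cong (λ _ _ → refl)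

  ⊗-congʳ : ∀ {n} (N : Matrix n) {M M′} → M ≋ M′ → (M ⊗ N) ≋ (M′ ⊗ N)
  ⊗-congʳ N M≋M′ = ⊗-cong M≋M′ (λ _ _ → refl)

  ⊗-assoc : ∀ {n} (M N Q : Matrix n) → ((M ⊗ N) ⊗ Q) ≋ (M ⊗ (N ⊗ Q))
  ⊗-assoc M N Q i j = begin
    ((M ⊗ N) ⊗ Q) i j
      ≈⟨ ⊗≈dot (M ⊗ N) Q i j ⟩
    sum (λ k → (M ⊗ N) i k * Q k j)
      ≈⟨ sum-cong-≋ (λ k → *-congʳ (⊗≈dot M N i k)) ⟩
    sum (λ k → sum (λ l → M i l * N l k) * Q k j)
      ≈⟨ sum-cong-≋ (λ k → *-distribʳ-sum (Q k j) (λ l → M i l * N l k)) ⟩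
    sum (λ k → sum (λ l → (M i l * N l k) * Q k j))
      ≈⟨ sum-cong-≋ (λ k → sum-cong-≋ (λ l → *-assoc (M i l) (N l k) (Q k j))) ⟩
    sum (λ k → sum (λ l → M i l * (N l k * Q k j)))
      ≈⟨ ∑-comm (λ k l → M i l * (N l k * Q k j)) ⟩
    sum (λ l → sum (λ k → M i l * (N l k * Q k j)))
      ≈⟨ sum-cong-≋ (λ l → *-distribˡ-sum (M i l) (λ k → N l k * Q k j)) ⟨
    sum (λ l → M i l * sum (λ k → N l k * Q k j))
      ≈⟨ sum-cong-≋ (λ l → *-congˡ (⊗≈dot N Q l j)) ⟨
    sum (λ l → M i l * (N ⊗ Q) l j)
      ≈⟨ ⊗≈dot M (N ⊗ Q) i j ⟨
    (M ⊗ (N ⊗ Q)) i j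
      ∎

  scale : ∀ {n} → Carrier → Matrix n → Matrix n
  scale a M i j = a * M i j

  scale-⊗ˡ : ∀ {n} a (M N : Matrix n) → (scale a M ⊗ N) ≋ scale a (M ⊗ N)
  scale-⊗ˡ a M N i j = begin
    (scale a M ⊗ N) i j                 ≈⟨ ⊗≈dot (scale a M) N i j ⟩
    dot (λ k → a * M i k) (col N j)     ≈⟨ dot-*ˡ a (M i) (col N j) ⟩
    a * dot (M i) (col N j)             ≈⟨ *-congˡ (⊗≈dot M N i j) ⟨
    a * (M ⊗ N) i j                     ∎

  scale-⊗ʳ : ∀ {n} a (M N : Matrix n) → (M ⊗ scale a N) ≋ scale a (M ⊗ N)
  scale-⊗ʳ a M N i j = begin
    (M ⊗ scale a N) i j                      ≈⟨ ⊗≈dot M (scale a N) i j ⟩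
    sum (λ k → M i k * (a * N k j))          ≈⟨ sum-cong-≋ (λ k → x∙yz≈y∙xz (M i k) a (N k j)) ⟩
    sum (λ k → a * (M i k * N k j))          ≈⟨ *-distribˡ-sum a (λ k → M i k * N k j) ⟨
    a * dot (M i) (col N j)                  ≈⟨ *-congˡ (⊗≈dot M N i j) ⟨
    a * (M ⊗ N) i j                          ∎

  module _ {s t : Carrier} (s*t≈1 : s * t ≈ 1#) where

    s*[t*x]≈x : ∀ x → s * (t * x) ≈ x
    s*[t*x]≈x x = trans (sym (*-assoc s t x)) (trans (*-congʳ s*t≈1) (*-identityˡ x))

    s*x≈y⇒x≈t*y : ∀ {x y} → s * x ≈ y → x ≈ t * y
    s*x≈y⇒x≈t*y {x} {y} s*x≈y = begin
      x             ≈⟨ *-identityˡ x ⟨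
      1# * x        ≈⟨ *-congʳ (trans (*-comm t s) s*t≈1) ⟨
      (t * s) * x   ≈⟨ *-assoc t s x ⟩
      t * (s * x)   ≈⟨ *-congˡ s*x≈y ⟩
      t * y         ∎

    groupInverse-of-A³≋sA : ∀ {n} {A X : Matrix n} → IsGroupInverse A X → ((A ⊗ A) ⊗ A) ≋ scale s A →
                            (A ⊗ X) ≋ scale t (A ⊗ A) × X ≋ scale t A
    groupInverse-of-A³≋sA {A = A} {X} (AXA≋A , XAX≋X , AX≋XA) A³≋sA = AX≋tA² , X≋tA
      where
      AX≋tA² : (A ⊗ X) ≋ scale t (A ⊗ A)
      AX≋tA² i j = s*x≈y⇒x≈t*y (begin
        s * (A ⊗ X) i j                ≈⟨ scale-⊗ˡ s A X i j ⟨
        (scale s A ⊗ X) i j            ≈⟨ ⊗-congʳ X A³≋sA i j ⟨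
        (((A ⊗ A) ⊗ A) ⊗ X) i j        ≈⟨ ⊗-assoc (A ⊗ A) A X i j ⟩
        ((A ⊗ A) ⊗ (A ⊗ X)) i j        ≈⟨ ⊗-congˡ (A ⊗ A) AX≋XA i j ⟩
        ((A ⊗ A) ⊗ (X ⊗ A)) i j        ≈⟨ ⊗-assoc A A (X ⊗ A) i j ⟩
        (A ⊗ (A ⊗ (X ⊗ A))) i j        ≈⟨ ⊗-congˡ A (⊗-assoc A X A) i j ⟨
        (A ⊗ ((A ⊗ X) ⊗ A)) i j        ≈⟨ ⊗-congˡ A AXA≋A i j ⟩
        (A ⊗ A) i j                    ∎)

      X≋tA : X ≋ scale t A
      X≋tA i j = begin
        X i j                                ≈⟨ XAX≋X i j ⟨
        ((X ⊗ A) ⊗ X) i j                    ≈⟨ ⊗-congʳ X AX≋XA i j ⟨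
        ((A ⊗ X) ⊗ X) i j                    ≈⟨ ⊗-congʳ X AX≋tA² i j ⟩
        (scale t (A ⊗ A) ⊗ X) i j            ≈⟨ scale-⊗ˡ t (A ⊗ A) X i j ⟩
        t * ((A ⊗ A) ⊗ X) i j                ≈⟨ *-congˡ (⊗-assoc A A X i j) ⟩
        t * (A ⊗ (A ⊗ X)) i j                ≈⟨ *-congˡ (⊗-congˡ A AX≋tA² i j) ⟩
        t * (A ⊗ scale t (A ⊗ A)) i j        ≈⟨ *-congˡ (scale-⊗ʳ t A (A ⊗ A) i j) ⟩
        t * (t * (A ⊗ (A ⊗ A)) i j)          ≈⟨ *-congˡ (*-congˡ (⊗-assoc A A A i j)) ⟨
        t * (t * ((A ⊗ A) ⊗ A) i j)          ≈⟨ *-congˡ (*-congˡ (A³≋sA i j)) ⟩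
        t * (t * (s * A i j))                ≈⟨ *-congˡ (s*x≈y⇒x≈t*y refl) ⟨
        t * A i j                            ∎

  -- Not-not-zero entries

  Negligible : Carrier → Set
  Negligible u = ¬ ¬ u ≈ 0#

  negligible-+ : ∀ {u v} → Negligible u → Negligible v → Negligible (u + v)
  negligible-+ ¬u≉0 ¬v≉0 u+v≉0 =
    ¬u≉0 (λ u≈0 → ¬v≉0 (λ v≈0 → u+v≉0 (trans (+-cong u≈0 v≈0) (+-identityʳ 0#))))

  negligible-* : ∀ a {u} → Negligible u → Negligible (a * u)
  negligible-* a ¬u≉0 au≉0 = ¬u≉0 (λ u≈0 → au≉0 (trans (*-congˡ u≈0) (zeroʳ a)))

  1-negligible≉0 : ∀ {u} → Negligible u → ¬ 1# - u ≈ 0#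
  1-negligible≉0 ¬u≉0 1-u≈0 = ¬u≉0 (λ u≈0 → 1≉0 (trans (x∙y⁻¹≈ε⇒x≈y _ _ 1-u≈0) u≈0))

  ¬¬-∀ : ∀ {n} {P : Fin n → Set} → (∀ i → ¬ ¬ P i) → ¬ ¬ (∀ i → P i)
  ¬¬-∀ {zero}  _   ¬all = ¬all (λ ())
  ¬¬-∀ {suc n} ¬¬P ¬all = ¬¬P zero λ P₀ → ¬¬-∀ (¬¬P ∘ suc) λ Pₛ → ¬all λ { zero → P₀ ; (suc i) → Pₛ i }

  -- Gaussian elimination stays constructive: the pivot 1 - U₀₀ is invertible as U₀₀ is negligible.
  negligible-fixedPoint≈0 : ∀ {n} (U : Matrix n) (v : Fin n → Carrier) →
                            (∀ i j → Negligible (U i j)) → (∀ i → v i ≈ mv U v i) → ∀ i → v i ≈ 0#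
  negligible-fixedPoint≈0 {suc m} U v U≈0 v≈Uv = v≈0
    where
    pivot≉0 = 1-negligible≉0 (U≈0 zero zero)
    δ = inverseOf (1# - U zero zero) pivot≉0
    v′ : Fin m → Carrier
    v′ = v ∘ suc
    ρ : Fin m → Carrier
    ρ k = δ * U zero (suc k)

    pivot*v₀≈ : (1# - U zero zero) * v zero ≈ dot (U zero ∘ suc) v′
    pivot*v₀≈ = begin
      (1# - U zero zero) * v zero          ≈⟨ [y-z]x≈yx-zx (v zero) 1# (U zero zero) ⟩
      1# * v zero - U zero zero * v zero   ≈⟨ +-congʳ (*-identityˡ (v zero)) ⟩
      v zero - U zero zero * v zero        ≈⟨ x≈y+z⇒x-y≈z (v≈Uv zero) ⟩
      dot (U zero ∘ suc) v′                ∎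

    v₀≈ρv′ : v zero ≈ dot ρ v′
    v₀≈ρv′ = trans (s*x≈y⇒x≈t*y (*-inverseOf _ pivot≉0) pivot*v₀≈) (sym (dot-*ˡ δ (U zero ∘ suc) v′))

    U′ : Matrix m
    U′ i k = U (suc i) (suc k) + U (suc i) zero * ρ k

    v′≈U′v′ : ∀ i → v′ i ≈ mv U′ v′ i
    v′≈U′v′ i = begin
      v′ i                                                       ≈⟨ v≈Uv (suc i) ⟩
      U (suc i) zero * v zero + dot (U (suc i) ∘ suc) v′         ≈⟨ +-comm _ _ ⟩
      dot (U (suc i) ∘ suc) v′ + U (suc i) zero * v zero         ≈⟨ +-congˡ (*-congˡ v₀≈ρv′) ⟩
      dot (U (suc i) ∘ suc) v′ + U (suc i) zero * dot ρ v′       ≈⟨ +-congˡ (dot-*ˡ _ ρ v′) ⟨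
      dot (U (suc i) ∘ suc) v′ + dot (λ k → U (suc i) zero * ρ k) v′
        ≈⟨ ∑-distrib-+ (λ k → U (suc i) (suc k) * v′ k) (λ k → U (suc i) zero * ρ k * v′ k) ⟨
      sum (λ k → U (suc i) (suc k) * v′ k + U (suc i) zero * ρ k * v′ k)
        ≈⟨ sum-cong-≋ (λ k → distribʳ (v′ k) _ _) ⟨
      mv U′ v′ i
        ∎

    U′-negligible : ∀ i k → Negligible (U′ i k)
    U′-negligible i k = negligible-+ (U≈0 (suc i) (suc k)) (negligible-* _ (negligible-* δ (U≈0 zero (suc k))))

    v′≈0 : ∀ i → v′ i ≈ 0#
    v′≈0 = negligible-fixedPoint≈0 U′ v′ U′-negligible v′≈U′v′

    v≈0 : ∀ i → v i ≈ 0#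
    v≈0 zero    = trans v₀≈ρv′ (sum-zero (λ k → trans (*-congˡ (v′≈0 k)) (zeroʳ (ρ k))))
    v≈0 (suc i) = v′≈0 i

  -- Graphs

  ≢-sym : ∀ {n} {i j : Fin n} → i ≢ j → j ≢ i
  ≢-sym i≢j j≡i = i≢j (≡.sym j≡i)

  walk-first-step : ∀ {n} {A : Matrix n} {i j} → Walk A i j → i ≢ j → ∃ λ k → Adj A i k
  walk-first-step here           i≢i = ⊥-elim (i≢i ≡.refl)
  walk-first-step (step {j = k} ik _) _ = k , ik

  walk-preserves : ∀ {n} {A : Matrix n} (P : Fin n → Set) → (∀ {u k} → P u → Adj A u k → P k) →
                   ∀ {u v} → Walk A u v → P u → P v
  walk-preserves P P-step here          Pu = Pu
  walk-preserves P P-step (step uk walk) Pu = walk-preserves P P-step walk (P-step Pu uk)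

  cycle : ∀ {n} {A : Matrix n} {k} (vs : Vec (Fin n) (suc (suc (suc k)))) → Unique vs →
          (∀ i → Adj A (lookup vs (inject₁ i)) (lookup vs (suc i))) →
          Adj A (lookup vs (fromℕ (suc (suc k)))) (lookup vs zero) → Cycle A
  cycle {k = k} vs vs-unique path closing =
    k , lookup vs , (λ {i} {j} → lookup-injective vs-unique i j) , path , closing

  -- a = d is allowed, so this also excludes triangles.
  NoPath₃ : ∀ {n} → Matrix n → Set
  NoPath₃ A = ∀ {a b c d} → Adj A a b → Adj A b c → Adj A c d → a ≢ c → b ≢ d → ⊥

  module Graph {n} {A : Matrix n} (symA : Symmetric A) (zdA : ZeroDiagonal A) where

    OtherNeighbour : Fin n → Fin n → Set
    OtherNeighbour x y = ∃ λ k → Adj A x k × k ≢ y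

    adj-sym : ∀ {i j} → Adj A i j → Adj A j i
    adj-sym ij ji≈0 = ij (trans (symA _ _) ji≈0)

    adj⇒≢ : ∀ {i j} → Adj A i j → i ≢ j
    adj⇒≢ {i} ii ≡.refl = ii (zdA i)

    module _ (acyclic : Acyclic A) where

      no-triangle : ∀ {a b c} → Adj A a b → Adj A b c → Adj A c a → ⊥
      no-triangle {a} {b} {c} ab bc ca = acyclic (cycle (a ∷ b ∷ c ∷ [])
        ((adj⇒≢ ab ∷ ≢-sym (adj⇒≢ ca) ∷ []) ∷ (adj⇒≢ bc ∷ []) ∷ [] ∷ [])
        (λ { zero → ab ; (suc zero) → bc }) ca)

      no-square : ∀ {a b c d} → Adj A a b → Adj A b c → Adj A c d → Adj A d a → a ≢ c → b ≢ d → ⊥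
      no-square {a} {b} {c} {d} ab bc cd da a≢c b≢d = acyclic (cycle (a ∷ b ∷ c ∷ d ∷ [])
        ((adj⇒≢ ab ∷ a≢c ∷ ≢-sym (adj⇒≢ da) ∷ []) ∷ (adj⇒≢ bc ∷ b≢d ∷ []) ∷ (adj⇒≢ cd ∷ []) ∷ [] ∷ [])
        (λ { zero → ab ; (suc zero) → bc ; (suc (suc zero)) → cd }) da)

    module _ (noPath₃ : NoPath₃ A) (connected : Connected A) where

      every-edge-meets-hub : ∀ {z p q} → Adj A z p → Adj A z q → p ≢ q →
                             ∀ i j → Adj A i j → i ≡ z ⊎ j ≡ z
      every-edge-meets-hub {z} {p} {q} zp zq p≢q i j ij with i ≟ z | j ≟ z
      ... | yes i≡z | _       = inj₁ i≡z
      ... | no _    | yes j≡z = inj₂ j≡z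
      ... | no i≢z  | no j≢z  =
        ⊥-elim (noPath₃ ij (near⇒adj j j≢z) (adj-sym (near⇒adj i i≢z)) i≢z (adj⇒≢ (adj-sym ij)))
        where
        Near : Fin n → Set
        Near u = u ≡ z ⊎ Adj A u z

        other-neighbour : ∀ u → OtherNeighbour z u
        other-neighbour u with p ≟ u
        ... | yes p≡u = q , zq , λ q≡u → p≢q (≡.trans p≡u (≡.sym q≡u))
        ... | no p≢u  = p , zp , p≢u

        near-step : ∀ {u k} → Near u → Adj A u k → Near k
        near-step (inj₁ ≡.refl) zk = inj₂ (adj-sym zk)
        near-step {u} {k} (inj₂ uz) uk with k ≟ z | other-neighbour u
        ... | yes k≡z | _            = inj₁ k≡z
        ... | no k≢z  | x , zx , x≢u = ⊥-elim (noPath₃ (adj-sym zx) (adj-sym uz) uk x≢u (≢-sym k≢z))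

        near⇒adj : ∀ u → u ≢ z → Adj A u z
        near⇒adj u u≢z with walk-preserves Near near-step (connected z u) (inj₁ ≡.refl)
        ... | inj₁ u≡z = ⊥-elim (u≢z u≡z)
        ... | inj₂ uz  = uz

      -- If c had a neighbour besides r, c would be a hub; if r had a neighbour besides c, r would be
      -- a hub and meet the edge p q; otherwise r and c would form a connected component.
      no-edge-avoids-neighbour : ∀ {r c p q} → Adj A r c → Adj A p q → r ≢ p → r ≢ q →
                                 ∀ {i j} → Adj A i j → i ≢ c → j ≢ c → ⊥
      no-edge-avoids-neighbour {r} {c} {p} {q} rc pq r≢p r≢q {i} {j} ij i≢c j≢c =
        ¬¬-excluded-middle {A = OtherNeighbour c r} λ
          { (yes (k , ck , k≢r)) →
              [ i≢c , j≢c ]′ (every-edge-meets-hub (adj-sym rc) ck (≢-sym k≢r) i j ij)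
          ; (no c-leaf) → ¬¬-excluded-middle {A = OtherNeighbour r c} λ
            { (yes (k , rk , k≢c)) →
                [ ≢-sym r≢p , ≢-sym r≢q ]′ (every-edge-meets-hub rc rk (≢-sym k≢c) p q pq)
            ; (no r-leaf) → component c-leaf r-leaf } }
        where
        InPair : Fin n → Set
        InPair u = u ≡ r ⊎ u ≡ c

        pair-step : ¬ OtherNeighbour c r → ¬ OtherNeighbour r c →
                    ∀ {u k} → InPair u → Adj A u k → InPair k
        pair-step _ r-leaf {k = k} (inj₁ ≡.refl) rk with k ≟ c
        ... | yes k≡c = inj₂ k≡c
        ... | no k≢c  = ⊥-elim (r-leaf (k , rk , k≢c))
        pair-step c-leaf _ {k = k} (inj₂ ≡.refl) ck with k ≟ r
        ... | yes k≡r = inj₁ k≡r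
        ... | no k≢r  = ⊥-elim (c-leaf (k , ck , k≢r))

        component : ¬ OtherNeighbour c r → ¬ OtherNeighbour r c → ⊥
        component c-leaf r-leaf
          with walk-preserves InPair (pair-step c-leaf r-leaf) (connected r i) (inj₁ ≡.refl)
        ... | inj₁ ≡.refl = r-leaf (j , ij , j≢c)
        ... | inj₂ i≡c    = i≢c i≡c

  -- Trees whose group inverse has the pattern of A

  module PatternOfGroupInverse {n} {A X : Matrix n} (symA : Symmetric A) (zdA : ZeroDiagonal A)
           (acyclic : Acyclic A) (samePattern : SamePattern A X) (AXA≋A : ((A ⊗ X) ⊗ A) ≋ A)
           (decA : ∀ i j → Dec (A i j ≈ 0#)) (decX : ∀ i j → Dec (X i j ≈ 0#)) where

    open Graph symA zdA

    X≉0⇒adj : ∀ {i j} → ¬ X i j ≈ 0# → Adj A i j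
    X≉0⇒adj {i} {j} Xij≉0 Aij≈0 = Xij≉0 (proj₁ (samePattern i j) Aij≈0)

    adj⇒X≉0 : ∀ {i j} → Adj A i j → ¬ X i j ≈ 0#
    adj⇒X≉0 {i} {j} ij Xij≈0 = ij (proj₂ (samePattern i j) Xij≈0)

    no-path₃ : NoPath₃ A
    no-path₃ {a} {b} {c} {d} ab bc cd a≢c b≢d with a ≟ d | decA a d
    ... | yes ≡.refl | _        = no-triangle acyclic ab bc cd
    ... | no _       | no ad    = no-square acyclic ab bc cd (adj-sym ad) a≢c b≢d
    ... | no a≢d     | yes ad≈0 = *-nonzero (*-nonzero ab (adj⇒X≉0 bc)) cd (begin
          A a b * X b c * A c d   ≈⟨ AXA-path ⟨
          ((A ⊗ X) ⊗ A) a d      ≈⟨ AXA≋A a d ⟩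
          A a d                  ≈⟨ ad≈0 ⟩
          0#                     ∎)
      where
      walk₂-avoiding-b : ∀ {x} → Adj A a x → Adj A x c → x ≢ b → ⊥
      walk₂-avoiding-b ax xc x≢b = no-square acyclic ax xc (adj-sym bc) (adj-sym ab) a≢c x≢b

      walk₃-avoiding-c : ∀ {x y} → Adj A a x → Adj A x y → Adj A y d → y ≢ c → ⊥
      walk₃-avoiding-c {x} {y} ax xy yd y≢c with x ≟ b | x ≟ c | y ≟ b | x ≟ d | y ≟ a
      ... | yes ≡.refl | _          | _          | _          | _          =
        no-square acyclic xy yd (adj-sym cd) (adj-sym bc) b≢d y≢c
      ... | no _       | yes ≡.refl | _          | _          | _          =
        no-triangle acyclic ab bc (adj-sym ax)
      ... | no _       | no _       | yes ≡.refl | _          | _          =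
        no-triangle acyclic bc cd (adj-sym yd)
      ... | no _       | no _       | no _       | yes ≡.refl | _          = ax ad≈0
      ... | no _       | no _       | no _       | no _       | yes ≡.refl = yd ad≈0
      ... | no x≢b     | no x≢c     | no y≢b     | no x≢d     | no y≢a     =
        acyclic (cycle (a ∷ x ∷ y ∷ d ∷ c ∷ b ∷ [])
          ( (adj⇒≢ ax ∷ ≢-sym y≢a ∷ a≢d ∷ a≢c ∷ adj⇒≢ ab ∷ [])
          ∷ (adj⇒≢ xy ∷ x≢d ∷ x≢c ∷ x≢b ∷ [])
          ∷ (adj⇒≢ yd ∷ y≢c ∷ y≢b ∷ [])
          ∷ (≢-sym (adj⇒≢ cd) ∷ ≢-sym b≢d ∷ [])
          ∷ (≢-sym (adj⇒≢ bc) ∷ [])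
          ∷ [] ∷ [])
          (λ { zero → ax ; (suc zero) → xy ; (suc (suc zero)) → yd
             ; (suc (suc (suc zero))) → adj-sym cd ; (suc (suc (suc (suc zero)))) → adj-sym bc })
          (adj-sym ab))

      AX-ac : (A ⊗ X) a c ≈ A a b * X b c
      AX-ac = trans (⊗≈dot A X a c) (sum-single b λ x x≢b →
        product≈0 (decA a x) (decX x c) λ ax xc → walk₂-avoiding-b ax (X≉0⇒adj xc) x≢b)

      AX-ay≈0 : ∀ {y} → y ≢ c → Adj A y d → (A ⊗ X) a y ≈ 0#
      AX-ay≈0 {y} y≢c yd = trans (⊗≈dot A X a y) (sum-zero λ x →
        product≈0 (decA a x) (decX x y) λ ax xy → walk₃-avoiding-c ax (X≉0⇒adj xy) yd y≢c)

      AXA-path : ((A ⊗ X) ⊗ A) a d ≈ A a b * X b c * A c d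
      AXA-path = begin
        ((A ⊗ X) ⊗ A) a d          ≈⟨ ⊗≈dot (A ⊗ X) A a d ⟩
        dot ((A ⊗ X) a) (col A d)  ≈⟨ sum-single c off-c-vanishes ⟩
        (A ⊗ X) a c * A c d        ≈⟨ *-congʳ AX-ac ⟩
        A a b * X b c * A c d      ∎
        where
        off-c-vanishes : ∀ y → y ≢ c → (A ⊗ X) a y * A y d ≈ 0#
        off-c-vanishes y y≢c with decA y d
        ... | yes yd≈0 = trans (*-congˡ yd≈0) (zeroʳ _)
        ... | no yd    = trans (*-congʳ (AX-ay≈0 y≢c yd)) (zeroˡ _)

  -- Stars

  module Star {n} {A X : Matrix n} (symA : Symmetric A) (zdA : ZeroDiagonal A) (gi : IsGroupInverse A X)
              (c : Fin n) (leaf-adj : ∀ i → i ≢ c → Adj A i c) (l : Fin n) (l≢c : l ≢ c)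
              (off-centre-negligible : ∀ i j → i ≢ c → j ≢ c → Negligible (A i j)) where

    w : Fin n → Carrier
    w = col A c

    e : Fin n → Carrier
    e k = identity k c

    s : Carrier
    s = dot w w

    s≉0 : ¬ s ≈ 0#
    s≉0 = sum-of-squares≉0 w l (leaf-adj l l≢c)

    t : Carrier
    t = inverseOf s s≉0

    s*t≈1 : s * t ≈ 1#
    s*t≈1 = *-inverseOf s s≉0

    t≉0 : ¬ t ≈ 0#
    t≉0 t≈0 = 1≉0 (trans (sym s*t≈1) (trans (*-congˡ t≈0) (zeroʳ s)))

    off-e*≈0 : ∀ {k} → k ≢ c → ∀ x → e k * x ≈ 0#
    off-e*≈0 k≢c x = trans (*-congʳ (identity-off k≢c)) (zeroˡ x)

    *-off-e≈0 : ∀ {k} → k ≢ c → ∀ x → x * e k ≈ 0#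
    *-off-e≈0 k≢c x = trans (*-congˡ (identity-off k≢c)) (zeroʳ x)

    w-c*≈0 : ∀ x → w c * x ≈ 0#
    w-c*≈0 x = trans (*-congʳ (zdA c)) (zeroˡ x)

    -- A² for a star: s e eᵀ + w wᵀ
    Q : Matrix n
    Q i j = e i * (s * e j) + w i * w j

    mv-Q : ∀ v i → mv Q v i ≈ e i * (s * v c) + w i * dot w v
    mv-Q v i = trans (dot-linearˡ (e i) (w i) (λ k → s * e k) w v)
                     (+-congʳ (*-congˡ (trans (dot-*ˡ s e v) (*-congˡ (dot-identity c v)))))

    OffCentreZero : Set
    OffCentreZero = ∀ i j → i ≢ c → j ≢ c → A i j ≈ 0#

    module WithOffCentreZero (off-centre-zero : OffCentreZero) where

      star-form : ∀ i j → A i j ≈ e i * w j + w i * e j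
      star-form i j = by-cases (i ≟ c) (j ≟ c)
        where
        by-cases : ∀ {i j} → Dec (i ≡ c) → Dec (j ≡ c) → A i j ≈ e i * w j + w i * e j
        by-cases {j = j} (yes ≡.refl) _ = begin
          A c j                   ≈⟨ symA c j ⟩
          w j                     ≈⟨ +-identityʳ (w j) ⟨
          w j + 0#                ≈⟨ +-cong (*-identityˡ (w j)) (w-c*≈0 (e j)) ⟨
          1# * w j + w c * e j    ≈⟨ +-congʳ (*-congʳ (identity-diag c)) ⟨
          e c * w j + w c * e j   ∎
        by-cases {i = i} (no i≢c) (yes ≡.refl) = begin
          A i c                   ≈⟨ +-identityˡ (w i) ⟨
          0# + w i                ≈⟨ +-cong (off-e*≈0 i≢c (w c)) (*-identityʳ (w i)) ⟨
          e i * w c + w i * 1#    ≈⟨ +-congˡ (*-congˡ (identity-diag c)) ⟨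
          e i * w c + w i * e c   ∎
        by-cases {i} {j} (no i≢c) (no j≢c) = begin
          A i j                   ≈⟨ off-centre-zero i j i≢c j≢c ⟩
          0#                      ≈⟨ +-identityʳ 0# ⟨
          0# + 0#                 ≈⟨ +-cong (off-e*≈0 i≢c (w j)) (*-off-e≈0 j≢c (w i)) ⟨
          e i * w j + w i * e j   ∎

      mv-A : ∀ v i → mv A v i ≈ e i * dot w v + w i * v c
      mv-A v i = begin
        mv A v i                                    ≈⟨ sum-cong-≋ (λ k → *-congʳ (star-form i k)) ⟩
        dot (λ k → e i * w k + w i * e k) v         ≈⟨ dot-linearˡ (e i) (w i) w e v ⟩
        e i * dot w v + w i * dot e v               ≈⟨ +-congˡ (*-congˡ (dot-identity c v)) ⟩
        e i * dot w v + w i * v c                   ∎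

      w·col : ∀ j → dot w (col A j) ≈ s * e j
      w·col j = begin
        dot w (col A j)          ≈⟨ sum-cong-≋ (λ k → trans (*-comm (w k) (A k j)) (*-congʳ (symA k j))) ⟩
        mv A w j                 ≈⟨ mv-A w j ⟩
        e j * s + w j * w c      ≈⟨ +-congˡ (trans (*-comm (w j) (w c)) (w-c*≈0 (w j))) ⟩
        e j * s + 0#             ≈⟨ +-identityʳ (e j * s) ⟩
        e j * s                  ≈⟨ *-comm (e j) s ⟩
        s * e j                  ∎

      square : (A ⊗ A) ≋ Q
      square i j = begin
        (A ⊗ A) i j                            ≈⟨ ⊗≈dot A A i j ⟩
        mv A (col A j) i                       ≈⟨ mv-A (col A j) i ⟩
        e i * dot w (col A j) + w i * A c j    ≈⟨ +-cong (*-congˡ (w·col j)) (*-congˡ (symA c j)) ⟩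
        Q i j                                  ∎

      cube : ((A ⊗ A) ⊗ A) ≋ scale s A
      cube i j = begin
        ((A ⊗ A) ⊗ A) i j                           ≈⟨ ⊗≈dot (A ⊗ A) A i j ⟩
        dot ((A ⊗ A) i) (col A j)                   ≈⟨ sum-cong-≋ (λ k → *-congʳ (square i k)) ⟩
        mv Q (col A j) i                            ≈⟨ mv-Q (col A j) i ⟩
        e i * (s * A c j) + w i * dot w (col A j)
          ≈⟨ +-cong (*-congˡ (*-congˡ (symA c j))) (*-congˡ (w·col j)) ⟩
        e i * (s * w j) + w i * (s * e j)
          ≈⟨ +-cong (x∙yz≈y∙xz (e i) s (w j)) (x∙yz≈y∙xz (w i) s (e j)) ⟩
        s * (e i * w j) + s * (w i * e j)
          ≈⟨ distribˡ s _ _ ⟨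
        s * (e i * w j + w i * e j)
          ≈⟨ *-congˡ (star-form i j) ⟨
        s * A i j
          ∎

      AX≋tQ : (A ⊗ X) ≋ scale t Q
      AX≋tQ i j = trans (proj₁ (groupInverse-of-A³≋sA s*t≈1 gi cube) i j) (*-congˡ (square i j))

      X≋tA : X ≋ scale t A
      X≋tA = proj₂ (groupInverse-of-A³≋sA s*t≈1 gi cube)

    ¬¬off-centre-zero : ¬ ¬ OffCentreZero
    ¬¬off-centre-zero = ¬¬-∀ λ i → ¬¬-∀ λ j → entry i j
      where
      entry : ∀ i j → ¬ ¬ (i ≢ c → j ≢ c → A i j ≈ 0#)
      entry i j with i ≟ c | j ≟ c
      ... | yes i≡c | _       = λ ¬entry → ¬entry (λ i≢c _ → ⊥-elim (i≢c i≡c))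
      ... | no _    | yes j≡c = λ ¬entry → ¬entry (λ _ j≢c → ⊥-elim (j≢c j≡c))
      ... | no i≢c  | no j≢c  = ¬¬-map (λ Aij≈0 _ _ → Aij≈0) (off-centre-negligible i j i≢c j≢c)

    E : Matrix n
    E = A ⊗ X

    D : Matrix n
    D k m = E k m - t * Q k m

    D-negligible : ∀ k m → Negligible (D k m)
    D-negligible k m D≉0 =
      ¬¬off-centre-zero λ oc → D≉0 (x≈y⇒x∙y⁻¹≈ε (WithOffCentreZero.AX≋tQ oc k m))

    Fixed : (Fin n → Carrier) → Set
    Fixed v = ∀ k → mv E v k ≈ v k

    column-fixed : ∀ m → Fixed (col A m)
    column-fixed m k = trans (sym (⊗≈dot E A k m)) (proj₁ gi k m)

    fixed-*ʳ : ∀ {v} a → Fixed v → Fixed (λ k → v k * a)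
    fixed-*ʳ {v} a v-fixed k = trans (dot-*ʳ a (E k) v) (*-congʳ (v-fixed k))

    fixed-− : ∀ {u v} → Fixed u → Fixed v → Fixed (λ k → u k - v k)
    fixed-− {u} {v} u-fixed v-fixed k =
      trans (dot-−ʳ (E k) u v) (+-cong (u-fixed k) (-‿cong (v-fixed k)))

    -- z′ = A(w_j eᵢ − w_i eⱼ) − μ w is fixed by AX and killed by Q, hence fixed by the negligible D,
    -- so z′ = 0; its entries i and j then give μ = −A_ij and μ = A_ij.
    off-centre-zero : OffCentreZero
    off-centre-zero i j i≢c j≢c = x≈-x⇒x≈0 (trans (sym μ≈b) μ≈-b)
      where
      z : Fin n → Carrier
      z k = A k i * w j - A k j * w i

      μ : Carrier
      μ = t * dot w z

      z′ : Fin n → Carrier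
      z′ k = z k - w k * μ

      z′-fixed : Fixed z′
      z′-fixed = fixed-− (fixed-− (fixed-*ʳ (w j) (column-fixed i)) (fixed-*ʳ (w i) (column-fixed j)))
                         (fixed-*ʳ μ (column-fixed c))

      z′c≈0 : z′ c ≈ 0#
      z′c≈0 = x≈y⇒x∙y⁻¹≈ε (begin
        A c i * w j - A c j * w i   ≈⟨ +-cong (*-congʳ (symA c i)) (-‿cong (*-congʳ (symA c j))) ⟩
        w i * w j - w j * w i       ≈⟨ x≈y⇒x∙y⁻¹≈ε (*-comm (w i) (w j)) ⟩
        0#                          ≈⟨ w-c*≈0 μ ⟨
        w c * μ                     ∎)

      w·z′≈0 : dot w z′ ≈ 0#
      w·z′≈0 = begin
        dot w z′                              ≈⟨ dot-−ʳ w z (λ k → w k * μ) ⟩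
        dot w z - dot w (λ k → w k * μ)       ≈⟨ +-congˡ (-‿cong (dot-*ʳ μ w w)) ⟩
        dot w z - s * μ                       ≈⟨ x≈y⇒x∙y⁻¹≈ε (sym (s*[t*x]≈x s*t≈1 (dot w z))) ⟩
        0#                                    ∎

      Qz′≈0 : ∀ k → mv Q z′ k ≈ 0#
      Qz′≈0 k = begin
        mv Q z′ k                            ≈⟨ mv-Q z′ k ⟩
        e k * (s * z′ c) + w k * dot w z′    ≈⟨ +-cong (*-congˡ (*-congˡ z′c≈0)) (*-congˡ w·z′≈0) ⟩
        e k * (s * 0#) + w k * 0#            ≈⟨ +-cong (trans (*-congˡ (zeroʳ s)) (zeroʳ (e k))) (zeroʳ (w k)) ⟩
        0# + 0#                              ≈⟨ +-identityʳ 0# ⟩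
        0#                                   ∎

      z′≈Dz′ : ∀ k → z′ k ≈ mv D z′ k
      z′≈Dz′ k = sym (begin
        mv D z′ k                                   ≈⟨ dot-−ˡ (E k) (λ m → t * Q k m) z′ ⟩
        mv E z′ k - dot (λ m → t * Q k m) z′        ≈⟨ +-cong (z′-fixed k) (-‿cong (dot-*ˡ t (Q k) z′)) ⟩
        z′ k - t * mv Q z′ k                        ≈⟨ +-congˡ (-‿cong (*-congˡ (Qz′≈0 k))) ⟩
        z′ k - t * 0#                               ≈⟨ +-congˡ (-‿cong (zeroʳ t)) ⟩
        z′ k - 0#                                   ≈⟨ +-congˡ -0#≈0# ⟩
        z′ k + 0#                                   ≈⟨ +-identityʳ (z′ k) ⟩
        z′ k                                        ∎)

      z≈wμ : ∀ k → z k ≈ w k * μ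
      z≈wμ k = x∙y⁻¹≈ε⇒x≈y _ _ (negligible-fixedPoint≈0 D z′ D-negligible z′≈Dz′ k)

      μ≈-b : μ ≈ - A i j
      μ≈-b = *-cancelˡ-nonzero (leaf-adj i i≢c) (begin
        w i * μ                       ≈⟨ z≈wμ i ⟨
        A i i * w j - A i j * w i     ≈⟨ +-congʳ (trans (*-congʳ (zdA i)) (zeroˡ (w j))) ⟩
        0# - A i j * w i              ≈⟨ +-identityˡ _ ⟩
        - (A i j * w i)               ≈⟨ -‿distribˡ-* (A i j) (w i) ⟩
        - A i j * w i                 ≈⟨ *-comm (- A i j) (w i) ⟩
        w i * - A i j                 ∎)

      μ≈b : μ ≈ A i j
      μ≈b = *-cancelˡ-nonzero (leaf-adj j j≢c) (begin
        w j * μ                       ≈⟨ z≈wμ j ⟨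
        A j i * w j - A j j * w i     ≈⟨ +-congˡ (-‿cong (trans (*-congʳ (zdA j)) (zeroˡ (w i)))) ⟩
        A j i * w j - 0#              ≈⟨ +-congˡ -0#≈0# ⟩
        A j i * w j + 0#              ≈⟨ +-identityʳ _ ⟩
        A j i * w j                   ≈⟨ *-congʳ (symA j i) ⟩
        A i j * w j                   ≈⟨ *-comm (A i j) (w j) ⟩
        w j * A i j                   ∎)

    X≋tA : X ≋ scale t A
    X≋tA = WithOffCentreZero.X≋tA off-centre-zero

  scale⇒samePattern : ∀ {n} {A X : Matrix n} {t} → ¬ t ≈ 0# → X ≋ scale t A → SamePattern A X
  scale⇒samePattern {t = t} t≉0 X≋tA i j =
    (λ Aij≈0 → trans (X≋tA i j) (trans (*-congˡ Aij≈0) (zeroʳ t))) ,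
    (λ Xij≈0 → x*y≈0⇒y≈0 t≉0 (trans (sym (X≋tA i j)) Xij≈0))

  zero⇒groupInverse≋zero : ∀ {n} {A X : Matrix n} → (∀ i j → A i j ≈ 0#) → IsGroupInverse A X →
                            ∀ i j → X i j ≈ 0#
  zero⇒groupInverse≋zero {A = A} {X} A≈0 (_ , XAX≋X , _) i j = begin
    X i j                         ≈⟨ XAX≋X i j ⟨
    ((X ⊗ A) ⊗ X) i j             ≈⟨ ⊗≈dot (X ⊗ A) X i j ⟩
    dot ((X ⊗ A) i) (col X j)     ≈⟨ sum-zero (λ k → trans (*-congʳ (XA≈0 k)) (zeroˡ (X k j))) ⟩
    0#                            ∎
    where
    XA≈0 : ∀ k → (X ⊗ A) i k ≈ 0#
    XA≈0 k = trans (⊗≈dot X A i k) (sum-zero (λ m → trans (*-congˡ (A≈0 m k)) (zeroʳ (X i m))))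

  centre-by-contradiction : ∀ {n} {A : Matrix n} c →
                            (∀ {i j} → Adj A i j → i ≢ c → j ≢ c → ⊥) → IsStar A
  centre-by-contradiction c no-edge-avoids-c = c , edge-meets-c
    where
    edge-meets-c : ∀ i j → _ → i ≡ c ⊎ j ≡ c
    edge-meets-c i j ij with i ≟ c | j ≟ c
    ... | yes i≡c | _       = inj₁ i≡c
    ... | no _    | yes j≡c = inj₂ j≡c
    ... | no i≢c  | no j≢c  = ⊥-elim (no-edge-avoids-c ij i≢c j≢c)

  other-vertex : ∀ {m} (c : Fin (suc (suc m))) → ∃ λ l → l ≢ c
  other-vertex c with c ≟ zero
  ... | yes c≡0 = suc zero , λ 1≡c → contradiction (≡.trans 1≡c c≡0) λ ()
  ... | no c≢0  = zero , ≢-sym c≢0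

  third-vertex : ∀ {m} (q : Fin (suc (suc (suc m)))) → ∃ λ r → r ≢ zero × r ≢ q
  third-vertex q with q ≟ suc zero
  ... | yes q≡1 = suc (suc zero) , (λ ()) , λ 2≡q → contradiction (≡.trans 2≡q q≡1) λ ()
  ... | no q≢1  = suc zero , (λ ()) , ≢-sym q≢1

  ¬¬-decidable : ∀ {n} (M : Matrix n) → ¬ ¬ (∀ i j → Dec (M i j ≈ 0#))
  ¬¬-decidable M = ¬¬-∀ λ i → ¬¬-∀ λ j → ¬¬-excluded-middle

  samePattern⇒isStar : ∀ {n} {A X : Matrix n} → IsWeightedTree A → IsGroupInverse A X →
                       SamePattern A X → IsStar A
  samePattern⇒isStar {zero} (() , _)
  samePattern⇒isStar {suc zero} _ _ _ = centre-by-contradiction zero λ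
    { {zero} _ 0≢0 _ → 0≢0 ≡.refl
    ; {suc ()} }
  samePattern⇒isStar {suc (suc zero)} {A} (_ , symA , zdA , _) _ _ = centre-by-contradiction zero λ
    { {zero} _ 0≢0 _ → 0≢0 ≡.refl
    ; {_} {zero} _ _ 0≢0 → 0≢0 ≡.refl
    ; {suc zero} {suc zero} 1-1 _ _ → Graph.adj⇒≢ symA zdA 1-1 ≡.refl }
  samePattern⇒isStar {suc (suc (suc m))} {A} {X}
    (_ , symA , zdA , connected , acyclic) (AXA≋A , _) samePattern
    with walk-first-step (connected zero (suc zero)) (λ ())
  ... | q , 0q with third-vertex q
  ... | r , r≢0 , r≢q with walk-first-step (connected r zero) r≢0
  ... | c , rc = centre-by-contradiction c λ ij i≢c j≢c →
    ¬¬-decidable A λ decA → ¬¬-decidable X λ decX →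
      no-edge-avoids-neighbour (no-path₃ decA decX) connected rc 0q r≢0 r≢q ij i≢c j≢c
    where
    open Graph symA zdA
    open PatternOfGroupInverse symA zdA acyclic samePattern AXA≋A using (no-path₃)

  isStar⇒samePattern : ∀ {n} {A X : Matrix n} → Symmetric A → ZeroDiagonal A → Connected A →
                       IsGroupInverse A X → IsStar A → SamePattern A X
  isStar⇒samePattern {suc zero} {A} {X} _ zdA _ gi _ i j = (λ _ → X≈0 i j) , (λ _ → A≈0 i j)
    where
    A≈0 : ∀ i j → A i j ≈ 0#
    A≈0 zero zero = zdA zero
    X≈0 = zero⇒groupInverse≋zero A≈0 gi
  isStar⇒samePattern {suc (suc m)} {A} symA zdA connected gi (c , edge-meets-c) =
    scale⇒samePattern t≉0 X≋tA
    where
    leaf-adj : ∀ i → i ≢ c → Adj A i c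
    leaf-adj i i≢c with walk-first-step (connected i c) i≢c
    ... | k , ik with edge-meets-c i k ik
    ...   | inj₁ i≡c    = ⊥-elim (i≢c i≡c)
    ...   | inj₂ ≡.refl = ik

    off-centre-negligible : ∀ i j → i ≢ c → j ≢ c → Negligible (A i j)
    off-centre-negligible i j i≢c j≢c ij with edge-meets-c i j ij
    ... | inj₁ i≡c = i≢c i≡c
    ... | inj₂ j≡c = j≢c j≡c

    other = other-vertex c
    open Star symA zdA gi c leaf-adj (proj₁ other) (proj₂ other) off-centre-negligible using (t≉0; X≋tA)

corollary2p13 : (F : OrderedField) (n : ℕ) (A X : Matrices.Matrix F n) →
    Matrices.IsWeightedTree F A → Matrices.Singular F A →
    Matrices.IsGroupInverse F A X →
    ((Matrices.SamePattern F A X → Matrices.IsStar F A) × (Matrices.IsStar F A → Matrices.SamePattern F A X))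
corollary2p13 F n A X tree@(_ , symA , zdA , connected , _) _ gi =
  samePattern⇒isStar F tree gi , isStar⇒samePattern F symA zdA connected gi
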